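{- Let $\sigma=\sigma_1\cdots\sigma_k$ be a Cayley permutation with $k\ge 2$. Then $\mathcal{S}^{\sigma}:\mathcal{C}\to\mathcal{C}$ is bijective if and only if $\sigma_1=\sigma_2$. In this case, $\mathcal{S}^{\sigma}$ is a bijection on $\mathcal{C}$ that preserves the multiset of entries of a Cayley permutation, and $\mathcal{R}\circ\mathcal{S}^{\sigma}$ is an involution on $\mathcal{C}$.
   Context: A Cayley permutation is a finite word $\pi=\pi_1\cdots\pi_n$ over the positive integers such that every integer from $1$ to $\max(\pi)$ occurs at least once; $\mathcal{C}$ is the set of all Cayley permutations. A word contains a pattern $p=p_1\cdots p_k$ if it has a subsequence $x_{i_1}\cdots x_{i_k}$ with $x_{i_u}<x_{i_v}$ iff $p_u<p_v$ and $x_{i_u}=x_{i_v}$ iff $p_u=p_v$; otherwise it avoids $p$. $\mathcal{R}$ is the reverse map on words. A $\sigma$-stack processes an input word from left to right with the following right-greedy algorithm: while the input is nonempty, if pushing the next input element onto the stack yields stack contents which, read from top to bottom, avoid $\sigma$, the element is pushed; otherwise the top element is popped and appended to the output. When the input is exhausted, the remaining elements are popped one by one. $\mathcal{S}^{\sigma}(\pi)$ denotes the output on input $\pi$. -}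

module Defs where

open import Data.Nat using (ℕ; zero; suc; _≤_; _⊔_; _<ᵇ_; _≡ᵇ_)
open import Data.Bool using (Bool; true; false; _∧_; if_then_else_; not)
open import Data.List using (List; []; _∷_; _++_; map; foldr; reverse)
open import Data.Bool.ListAction using (any)
open import Data.List.Relation.Unary.All using (All)
open import Data.List.Membership.Propositional using (_∈_)
open import Data.List.Relation.Binary.Permutation.Propositional using (_↭_)
open import Data.Product using (_×_; Σ; ∃-syntax; _,_)
open import Relation.Binary.PropositionalEquality using (_≡_)

Word : Set
Word = List ℕ

maxW : Word → ℕ
maxW = foldr _⊔_ 0

IsCayley : Word → Set
IsCayley π = All (λ x → 1 ≤ x) π × (∀ i → 1 ≤ i → i ≤ maxW π → i ∈ π)

_==_ : Bool → Bool → Bool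
true == b = b
false == b = not b

sameRel : ℕ → ℕ → ℕ → ℕ → Bool
sameRel a b c d = ((a <ᵇ b) == (c <ᵇ d)) ∧ ((b <ᵇ a) == (d <ᵇ c)) ∧ ((a ≡ᵇ b) == (c ≡ᵇ d))

headRel : ℕ → ℕ → Word → Word → Bool
headRel p x [] [] = true
headRel p x (q ∷ ps) (y ∷ xs) = sameRel p q x y ∧ headRel p x ps xs
headRel p x _ _ = false

orderIso : Word → Word → Bool
orderIso [] [] = true
orderIso (p ∷ ps) (x ∷ xs) = headRel p x ps xs ∧ orderIso ps xs
orderIso _ _ = false

subseqs : Word → List Word
subseqs [] = [] ∷ []
subseqs (x ∷ xs) = map (x ∷_) (subseqs xs) ++ subseqs xs

contains : Word → Word → Bool
contains w p = any (orderIso p) (subseqs w)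

-- The stack is a list whose head is the top.
-- push σ x st out: pop the top while pushing x would make the stack contain σ
-- (reading top to bottom); returns (new stack, output so far).
push : Word → ℕ → Word → Word → Word × Word
push σ x [] out = (x ∷ [] , out)
push σ x (y ∷ st) out =
  if contains (x ∷ y ∷ st) σ then push σ x st (out ++ (y ∷ []))
  else (x ∷ y ∷ st , out)

run : Word → Word → Word → Word → Word
run σ [] st out = out ++ st
run σ (x ∷ xs) st out with push σ x st out
... | (st' , out') = run σ xs st' out'

stackSort : Word → Word → Word
stackSort σ π = run σ π [] []

BijectiveOnC : (Word → Word) → Set
BijectiveOnC f =
  (∀ π → IsCayley π → IsCayley (f π))
  × (∀ π τ → IsCayley π → IsCayley τ → f π ≡ f τ → π ≡ τ)
  × (∀ τ → IsCayley τ → Σ Word λ π → IsCayley π × f π ≡ τ)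

-- Feed the output of the σ-stack back, read backwards, into the machine. Invariant: started
-- from the current stack, the machine then outputs the input read so far, backwards. To keep
-- it across a push of z that pops y₁ … yₘ and leaves s, the last popped letter yₘ must be
-- unable to sit on z s. It was popped because z yₘ s contains σ, while z s (the new stack)
-- and yₘ s (a suffix of the old one) avoid σ; so an occurrence of σ in z yₘ s uses z and yₘ
-- as σ₁ σ₂, and σ₁ = σ₂ gives z = yₘ. Hence R ∘ S^σ is an involution, and since S^σ only
-- permutes the entries it is a bijection of C. If σ₁ ≠ σ₂, then S^σ sends both R(σ) and
-- R(σ₂σ₁σ₃⋯σₖ) to σ₂σ₁σ₃⋯σₖ.

module Submission where

open import Defs
open import Algebra.Bundles using (CommutativeMonoid)
open import Data.Bool using (true; false; T)
open import Data.Unit using (⊤)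
open import Data.Bool.Properties using (T-≡; T-∧)
open import Data.Empty using (⊥-elim)
open import Data.List using ([]; _∷_; _++_; [_]; map; length; reverse)
open import Data.List.Properties
  using (++-assoc; ++-identityʳ; reverse-++; reverse-involutive; reverse-injective; unfold-reverse; ∷-injectiveˡ)
open import Data.List.Membership.Propositional using (_∈_; find; lose)
open import Data.List.Membership.Propositional.Properties using (∈-++⁺ˡ; ∈-++⁺ʳ; ∈-++⁻; ∈-map⁺; ∈-map⁻)
open import Data.List.Relation.Unary.Any using (here)
open import Data.List.Relation.Unary.Any.Properties using (any⁺; any⁻)
open import Data.List.Relation.Binary.Equality.Propositional using (≋⇒≡)
open import Data.List.Relation.Binary.Sublist.Propositional using (_⊆_; []; _∷_; _∷ʳ_; ⊆-refl; ⊆-trans)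
open import Data.List.Relation.Binary.Sublist.Propositional.Properties using (length-mono-≤; to-≋; ++⁺ˡ)
open import Data.List.Relation.Binary.Permutation.Propositional
  using (_↭_; ↭-refl; ↭-sym; ↭-trans; ↭-reflexive; ↭-swap; ↭⇒↭ₛ; module PermutationReasoning)
open import Data.List.Relation.Binary.Permutation.Propositional.Properties
  using (shift; All-resp-↭; ∈-resp-↭; ↭-reverse) renaming (++⁺ˡ to ↭-++⁺ˡ; ++⁺ʳ to ↭-++⁺ʳ)
open import Data.List.Relation.Binary.Permutation.Setoid.Properties using (foldr-commMonoid)
open import Data.Nat using (ℕ; zero; suc; _≤_; _<_; _<ᵇ_; _≡ᵇ_; _≟_)
open import Data.Nat.Properties using (≡ᵇ⇒≡; ≤-trans; ≤-reflexive; <-irrefl; n<1+n; ⊔-0-commutativeMonoid)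
open import Data.Product using (_×_; Σ; ∃-syntax; ∃₂; _,_; proj₁; proj₂; map₂)
open import Data.Sum using (_⊎_; inj₁; inj₂)
open import Function using (_∘_)
open import Function.Bundles using (_⇔_; mk⇔; Equivalence)
open import Relation.Binary.PropositionalEquality
  using (_≡_; refl; sym; trans; cong; subst; subst₂; module ≡-Reasoning)
open import Relation.Nullary using (¬_)
open import Relation.Nullary.Decidable using (decidable-stable)

-- Pattern containment

∈-subseqs⁺ : ∀ {u w} → u ⊆ w → u ∈ subseqs w
∈-subseqs⁺ [] = here refl
∈-subseqs⁺ {w = x ∷ w} (refl ∷ u⊆w) = ∈-++⁺ˡ (∈-map⁺ (x ∷_) (∈-subseqs⁺ u⊆w))
∈-subseqs⁺ {w = x ∷ w} (.x ∷ʳ u⊆w) = ∈-++⁺ʳ (map (x ∷_) (subseqs w)) (∈-subseqs⁺ u⊆w)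

∈-subseqs⁻ : ∀ {u} w → u ∈ subseqs w → u ⊆ w
∈-subseqs⁻ [] (here refl) = []
∈-subseqs⁻ (x ∷ w) u∈ with ∈-++⁻ (map (x ∷_) (subseqs w)) u∈
... | inj₂ u∈w = x ∷ʳ ∈-subseqs⁻ w u∈w
... | inj₁ u∈x∷w with ∈-map⁻ (x ∷_) u∈x∷w
...   | v , v∈w , refl = refl ∷ ∈-subseqs⁻ w v∈w

==-refl : ∀ b → T (b == b)
==-refl true = _
==-refl false = _

sameRel-refl : ∀ a b → T (sameRel a b a b)
sameRel-refl a b =
  Equivalence.from T-∧ (==-refl (a <ᵇ b) , Equivalence.from T-∧ (==-refl (b <ᵇ a) , ==-refl (a ≡ᵇ b)))

headRel-refl : ∀ p ps → T (headRel p p ps ps)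
headRel-refl p [] = _
headRel-refl p (q ∷ ps) = Equivalence.from T-∧ (sameRel-refl p q , headRel-refl p ps)

orderIso-refl : ∀ w → T (orderIso w w)
orderIso-refl [] = _
orderIso-refl (p ∷ ps) = Equivalence.from T-∧ (headRel-refl p ps , orderIso-refl ps)

orderIso-length : ∀ p v → T (orderIso p v) → length p ≡ length v
orderIso-length [] [] _ = refl
orderIso-length (p ∷ ps) (x ∷ xs) iso = cong suc (orderIso-length ps xs (proj₂ (Equivalence.to T-∧ iso)))

orderIso⇒sameRel : ∀ p q ps x y xs → T (orderIso (p ∷ q ∷ ps) (x ∷ y ∷ xs)) → T (sameRel p q x y)
orderIso⇒sameRel p q ps x y xs iso with sameRel p q x y
... | true = _

sameRel-repeated⇒≡ : ∀ a x y → T (sameRel a a x y) → x ≡ y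
sameRel-repeated⇒≡ a x y same with (a <ᵇ a) == (x <ᵇ y) | (a <ᵇ a) == (y <ᵇ x)
... | true | true = equal a same
  where
  equal : ∀ a → T ((a ≡ᵇ a) == (x ≡ᵇ y)) → x ≡ y
  equal zero = ≡ᵇ⇒≡ x y
  equal (suc a) = equal a

sameRel-swapped⇒≡ : ∀ a b → T (sameRel a b b a) → a ≡ b
sameRel-swapped⇒≡ a b = equal a b ∘ proj₁ ∘ Equivalence.to (T-∧ {(a <ᵇ b) == (b <ᵇ a)})
  where
  equal : ∀ a b → T ((a <ᵇ b) == (b <ᵇ a)) → a ≡ b
  equal zero zero _ = refl
  equal (suc a) (suc b) t = cong suc (equal a b t)

contains⁺ : ∀ {v w} p → v ⊆ w → T (orderIso p v) → contains w p ≡ true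
contains⁺ p v⊆w iso = Equivalence.to T-≡ (any⁺ (orderIso p) (lose (∈-subseqs⁺ v⊆w) iso))

contains⁻ : ∀ w p → contains w p ≡ true → ∃[ v ] v ⊆ w × T (orderIso p v)
contains⁻ w p c with find (any⁻ (orderIso p) (subseqs w) (Equivalence.from T-≡ c))
... | v , v∈ , iso = v , ∈-subseqs⁻ w v∈ , iso

avoids⇒¬orderIso : ∀ {v w} p → contains w p ≡ false → v ⊆ w → ¬ T (orderIso p v)
avoids⇒¬orderIso p w∌p v⊆w iso with trans (sym (contains⁺ p v⊆w iso)) w∌p
... | ()

contains-refl : ∀ w → contains w w ≡ true
contains-refl w = contains⁺ w ⊆-refl (orderIso-refl w)

contains-mono : ∀ {u w} p → u ⊆ w → contains u p ≡ true → contains w p ≡ true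
contains-mono {u} p u⊆w c with contains⁻ u p c
... | v , v⊆u , iso = contains⁺ p (⊆-trans v⊆u u⊆w) iso

avoids-antimono : ∀ {u w} p → u ⊆ w → contains w p ≡ false → contains u p ≡ false
avoids-antimono {u} p u⊆w w∌p with contains u p in c
... | false = refl
... | true with contains⁻ u p c
...   | v , v⊆u , iso = ⊥-elim (avoids⇒¬orderIso p w∌p (⊆-trans v⊆u u⊆w) iso)

avoids-longer : ∀ w p → length w < length p → contains w p ≡ false
avoids-longer w p w<p with contains w p in c
... | false = refl
... | true with contains⁻ w p c
...   | v , v⊆w , iso =
  ⊥-elim (<-irrefl refl (≤-trans w<p (≤-trans (≤-reflexive (orderIso-length p v iso)) (length-mono-≤ v⊆w))))

contains-sameLength⇒orderIso : ∀ w p → length w ≡ length p → contains w p ≡ true → T (orderIso p w)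
contains-sameLength⇒orderIso w p |w|≡|p| c with contains⁻ w p c
... | v , v⊆w , iso with ≋⇒≡ (to-≋ (trans (sym (orderIso-length p v iso)) (sym |w|≡|p|)) v⊆w)
...   | refl = iso

adjacent-occurrence⇒≡ : ∀ a rest z y s →
  contains (z ∷ y ∷ s) (a ∷ a ∷ rest) ≡ true →
  contains (z ∷ s) (a ∷ a ∷ rest) ≡ false → contains (y ∷ s) (a ∷ a ∷ rest) ≡ false → z ≡ y
adjacent-occurrence⇒≡ a rest z y s c z∌σ y∌σ with contains⁻ (z ∷ y ∷ s) (a ∷ a ∷ rest) c
... | v , _ ∷ʳ v⊆ys , iso = ⊥-elim (avoids⇒¬orderIso (a ∷ a ∷ rest) y∌σ v⊆ys iso)
... | v , refl ∷ (_ ∷ʳ v⊆s) , iso = ⊥-elim (avoids⇒¬orderIso (a ∷ a ∷ rest) z∌σ (refl ∷ v⊆s) iso)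
... | z ∷ y ∷ v , refl ∷ (refl ∷ _) , iso =
  sameRel-repeated⇒≡ a z y (orderIso⇒sameRel a a rest z y v iso)

swapped-avoids : ∀ a b rest → ¬ a ≡ b → contains (b ∷ a ∷ rest) (a ∷ b ∷ rest) ≡ false
swapped-avoids a b rest a≢b with contains (b ∷ a ∷ rest) (a ∷ b ∷ rest) in c
... | false = refl
... | true = ⊥-elim (a≢b (sameRel-swapped⇒≡ a b
  (orderIso⇒sameRel a b rest b a rest (contains-sameLength⇒orderIso (b ∷ a ∷ rest) (a ∷ b ∷ rest) refl c))))

-- The stack machine

push-avoiding : ∀ σ y st out → contains (y ∷ st) σ ≡ false → push σ y st out ≡ (y ∷ st , out)
push-avoiding σ y [] out _ = refl
push-avoiding σ y (w ∷ st) out y∷st∌σ rewrite y∷st∌σ = refl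

push-pops : ∀ σ z w st out → contains (z ∷ w ∷ st) σ ≡ true →
  push σ z (w ∷ st) out ≡ push σ z st (out ++ [ w ])
push-pops σ z w st out forced rewrite forced = refl

push-++ˡ : ∀ σ x st o₁ o₂ → push σ x st (o₁ ++ o₂) ≡ map₂ (o₁ ++_) (push σ x st o₂)
push-++ˡ σ x [] o₁ o₂ = refl
push-++ˡ σ x (w ∷ st) o₁ o₂ with contains (x ∷ w ∷ st) σ
... | true rewrite ++-assoc o₁ o₂ [ w ] = push-++ˡ σ x st o₁ (o₂ ++ [ w ])
... | false = refl

run-++ˡ : ∀ σ xs st o₁ o₂ → run σ xs st (o₁ ++ o₂) ≡ o₁ ++ run σ xs st o₂
run-++ˡ σ [] st o₁ o₂ = ++-assoc o₁ o₂ st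
run-++ˡ σ (x ∷ xs) st o₁ o₂ rewrite push-++ˡ σ x st o₁ o₂ = run-++ˡ σ xs _ o₁ _

run-reverse-avoiding : ∀ σ t s r out → contains (t ++ s) σ ≡ false →
  run σ (reverse t ++ r) s out ≡ run σ r (t ++ s) out
run-reverse-avoiding σ [] s r out _ = refl
run-reverse-avoiding σ (y ∷ t) s r out y∷t∌σ
  rewrite reverse-++ [ y ] t | ++-assoc (reverse t) [ y ] r
        | run-reverse-avoiding σ t s (y ∷ r) out (avoids-antimono σ (y ∷ʳ ⊆-refl {x = t ++ s}) y∷t∌σ)
        | push-avoiding σ y (t ++ s) out y∷t∌σ = refl

LastPopForced : Word → ℕ → Word → Word → Set
LastPopForced σ z popped kept =
  popped ≡ [] ⊎ ∃₂ λ popped′ y → popped ≡ popped′ ++ [ y ] × contains (z ∷ y ∷ kept) σ ≡ true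

record PushDecomposition (σ : Word) (z : ℕ) (st out : Word) : Set where
  constructor decomposition
  field
    popped kept : Word
    stack-split : st ≡ popped ++ kept
    push-result : push σ z st out ≡ (z ∷ kept , out ++ popped)
    kept-avoids : contains (z ∷ kept) σ ≡ false
    last-pop-forced : LastPopForced σ z popped kept

push-decomposition : ∀ p q ps z st out → PushDecomposition (p ∷ q ∷ ps) z st out
push-decomposition p q ps z [] out =
  decomposition [] [] refl (cong (z ∷ [] ,_) (sym (++-identityʳ out))) refl (inj₁ refl)
push-decomposition p q ps z (w ∷ st) out with contains (z ∷ w ∷ st) (p ∷ q ∷ ps) in forced
... | false =
  decomposition [] (w ∷ st) refl
    (trans (push-avoiding (p ∷ q ∷ ps) z (w ∷ st) out forced) (cong (z ∷ w ∷ st ,_) (sym (++-identityʳ out))))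
    forced (inj₁ refl)
... | true with push-decomposition p q ps z st (out ++ [ w ])
...   | decomposition popped kept refl result avoids last =
  decomposition (w ∷ popped) kept refl
    (trans (push-pops (p ∷ q ∷ ps) z w (popped ++ kept) out forced)
           (trans result (cong (z ∷ kept ,_) (++-assoc out [ w ] popped))))
    avoids (last-forced last)
  where
  last-forced : LastPopForced (p ∷ q ∷ ps) z popped kept → LastPopForced (p ∷ q ∷ ps) z (w ∷ popped) kept
  last-forced (inj₁ refl) = inj₂ ([] , w , refl , forced)
  last-forced (inj₂ (popped′ , y , refl , y-forced)) = inj₂ (w ∷ popped′ , y , refl , y-forced)

HeadForcesPop : Word → Word → Word → Set
HeadForcesPop σ [] _ = ⊤
HeadForcesPop σ (y ∷ _) st = contains (y ∷ st) σ ≡ true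

HeadForcesPop-mono : ∀ σ w {s t} → s ⊆ t → HeadForcesPop σ w s → HeadForcesPop σ w t
HeadForcesPop-mono σ [] _ _ = _
HeadForcesPop-mono σ (y ∷ _) s⊆t forced = contains-mono σ (refl ∷ s⊆t) forced

run-head-forces-pop : ∀ σ w z s → HeadForcesPop σ w (z ∷ s) → run σ w (z ∷ s) [] ≡ z ∷ run σ w s []
run-head-forces-pop σ [] z s _ = refl
run-head-forces-pop σ (y ∷ w) z s forced rewrite forced = run-++ˡ σ (y ∷ w) s [ z ] []

-- Preservation of the entries

push-↭ : ∀ σ x st out → proj₂ (push σ x st out) ++ proj₁ (push σ x st out) ↭ out ++ x ∷ st
push-↭ σ x [] out = ↭-refl
push-↭ σ x (w ∷ st) out with contains (x ∷ w ∷ st) σ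
... | true = ↭-trans (push-↭ σ x st (out ++ [ w ]))
               (↭-trans (↭-reflexive (++-assoc out [ w ] (x ∷ st))) (↭-++⁺ˡ out (↭-swap w x ↭-refl)))
... | false = ↭-refl

run-↭ : ∀ σ xs st out → run σ xs st out ↭ (out ++ st) ++ xs
run-↭ σ [] st out = ↭-reflexive (sym (++-identityʳ _))
run-↭ σ (x ∷ xs) st out = begin
  run σ xs _ _                            ↭⟨ run-↭ σ xs _ _ ⟩
  (proj₂ pushed ++ proj₁ pushed) ++ xs    ↭⟨ ↭-++⁺ʳ xs (push-↭ σ x st out) ⟩
  (out ++ x ∷ st) ++ xs                   ≡⟨ ++-assoc out (x ∷ st) xs ⟩
  out ++ x ∷ st ++ xs                     ↭⟨ ↭-++⁺ˡ out (shift x st xs) ⟨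
  out ++ st ++ x ∷ xs                     ≡⟨ ++-assoc out st (x ∷ xs) ⟨
  (out ++ st) ++ x ∷ xs                   ∎
  where
  open PermutationReasoning
  pushed : Word × Word
  pushed = push σ x st out

stackSort-↭ : ∀ σ π → stackSort σ π ↭ π
stackSort-↭ σ π = run-↭ σ π [] []

maxW-↭ : ∀ {xs ys} → xs ↭ ys → maxW xs ≡ maxW ys
maxW-↭ p = foldr-commMonoid ⊔-0.setoid ⊔-0.isCommutativeMonoid (↭⇒↭ₛ p)
  where module ⊔-0 = CommutativeMonoid ⊔-0-commutativeMonoid

IsCayley-resp-↭ : ∀ {xs ys} → xs ↭ ys → IsCayley xs → IsCayley ys
IsCayley-resp-↭ p (positive , surjective) =
  All-resp-↭ p positive ,
  λ i 1≤i i≤max → ∈-resp-↭ p (surjective i 1≤i (subst (i ≤_) (sym (maxW-↭ p)) i≤max))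

-- Rewinding the machine

record Rewindable (σ consumed st out : Word) : Set where
  constructor rewindable
  field
    stack-avoids : contains st σ ≡ false
    head-forces-pop : HeadForcesPop σ (reverse out) st
    rewinds : run σ (reverse out) st [] ≡ reverse consumed

rewindable-start : ∀ p ps → Rewindable (p ∷ ps) [] [] []
rewindable-start p ps = rewindable refl _ refl

rewindable-finish : ∀ σ {consumed st out} → Rewindable σ consumed st out →
  run σ (reverse (out ++ st)) [] [] ≡ reverse consumed
rewindable-finish σ {consumed} {st} {out} (rewindable st∌σ _ rewinds) = begin
  run σ (reverse (out ++ st)) [] []       ≡⟨ cong (λ w → run σ w [] []) (reverse-++ out st) ⟩
  run σ (reverse st ++ reverse out) [] [] ≡⟨ run-reverse-avoiding σ st [] (reverse out) [] st++[]∌σ ⟩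
  run σ (reverse out) (st ++ []) []       ≡⟨ cong (λ s → run σ (reverse out) s []) (++-identityʳ st) ⟩
  run σ (reverse out) st []               ≡⟨ rewinds ⟩
  reverse consumed                        ∎
  where
  open ≡-Reasoning
  st++[]∌σ : contains (st ++ []) σ ≡ false
  st++[]∌σ = subst (λ s → contains s σ ≡ false) (sym (++-identityʳ st)) st∌σ

module _ (a : ℕ) (rest : Word) where

  private
    σ : Word
    σ = a ∷ a ∷ rest

  head-forces-pop-after-push : ∀ {z popped kept} out →
    contains (popped ++ kept) σ ≡ false → contains (z ∷ kept) σ ≡ false → LastPopForced σ z popped kept →
    HeadForcesPop σ (reverse out) (popped ++ kept) → HeadForcesPop σ (reverse (out ++ popped)) (z ∷ kept)
  head-forces-pop-after-push {z} {kept = kept} out _ _ (inj₁ refl) forced =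
    subst (λ o → HeadForcesPop σ (reverse o) (z ∷ kept)) (sym (++-identityʳ out))
      (HeadForcesPop-mono σ (reverse out) (z ∷ʳ ⊆-refl) forced)
  head-forces-pop-after-push {z} {kept = kept} out st∌σ z∷kept∌σ
                             (inj₂ (popped′ , y , refl , z-over-y-forced)) _ =
    subst (λ w → HeadForcesPop σ w (z ∷ kept))
      (sym (trans (cong reverse (sym (++-assoc out popped′ [ y ]))) (reverse-++ (out ++ popped′) [ y ])))
      (subst₂ (λ u v → contains (u ∷ v ∷ kept) σ ≡ true) z≡y (sym z≡y) z-over-y-forced)
    where
    y∷kept∌σ : contains (y ∷ kept) σ ≡ false
    y∷kept∌σ = avoids-antimono σ
      (subst (y ∷ kept ⊆_) (sym (++-assoc popped′ [ y ] kept)) (++⁺ˡ popped′ ⊆-refl)) st∌σ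
    z≡y : z ≡ y
    z≡y = adjacent-occurrence⇒≡ a rest z y kept z-over-y-forced z∷kept∌σ y∷kept∌σ

  rewindable-push : ∀ {consumed z st out} → Rewindable σ consumed st out →
    (d : PushDecomposition σ z st out) →
    Rewindable σ (consumed ++ [ z ]) (z ∷ PushDecomposition.kept d) (out ++ PushDecomposition.popped d)
  rewindable-push {consumed} {z} {out = out} (rewindable st∌σ st-forced rewinds)
                  (decomposition popped kept refl _ z∷kept∌σ last-forced) =
    rewindable z∷kept∌σ forces rewinds′
    where
    forces : HeadForcesPop σ (reverse (out ++ popped)) (z ∷ kept)
    forces = head-forces-pop-after-push out st∌σ z∷kept∌σ last-forced st-forced

    rewinds′ : run σ (reverse (out ++ popped)) (z ∷ kept) [] ≡ reverse (consumed ++ [ z ])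
    rewinds′ = begin
      run σ (reverse (out ++ popped)) (z ∷ kept) []
        ≡⟨ run-head-forces-pop σ (reverse (out ++ popped)) z kept forces ⟩
      z ∷ run σ (reverse (out ++ popped)) kept []
        ≡⟨ cong (λ w → z ∷ run σ w kept []) (reverse-++ out popped) ⟩
      z ∷ run σ (reverse popped ++ reverse out) kept []
        ≡⟨ cong (z ∷_) (run-reverse-avoiding σ popped kept (reverse out) [] st∌σ) ⟩
      z ∷ run σ (reverse out) (popped ++ kept) []
        ≡⟨ cong (z ∷_) rewinds ⟩
      z ∷ reverse consumed
        ≡⟨ reverse-++ consumed [ z ] ⟨
      reverse (consumed ++ [ z ]) ∎
      where open ≡-Reasoning

  run-rewinds : ∀ xs {consumed st out} → Rewindable σ consumed st out →
    run σ (reverse (run σ xs st out)) [] [] ≡ reverse (consumed ++ xs)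
  run-rewinds [] {consumed} r = trans (rewindable-finish σ r) (cong reverse (sym (++-identityʳ consumed)))
  run-rewinds (z ∷ xs) {consumed} {st} {out} r with push-decomposition a a rest z st out
  ... | d@(decomposition _ _ _ pushed _ _) rewrite pushed =
    trans (run-rewinds xs (rewindable-push r d)) (cong reverse (++-assoc consumed [ z ] xs))

  reverse∘stackSort-involutive : ∀ π → reverse (stackSort σ (reverse (stackSort σ π))) ≡ π
  reverse∘stackSort-involutive π =
    trans (cong reverse (run-rewinds π (rewindable-start a (a ∷ rest)))) (reverse-involutive π)

-- Bijectivity

reverse-involution⇒bijectiveOnC : ∀ f → (∀ π → f π ↭ π) →
  (∀ π → reverse (f (reverse (f π))) ≡ π) → BijectiveOnC f
reverse-involution⇒bijectiveOnC f f-↭ f-inv = into , injective , surjective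
  where
  into : ∀ π → IsCayley π → IsCayley (f π)
  into π = IsCayley-resp-↭ (↭-sym (f-↭ π))

  injective : ∀ π τ → IsCayley π → IsCayley τ → f π ≡ f τ → π ≡ τ
  injective π τ _ _ fπ≡fτ = trans (sym (f-inv π)) (trans (cong (reverse ∘ f ∘ reverse) fπ≡fτ) (f-inv τ))

  surjective : ∀ τ → IsCayley τ → Σ Word λ π → IsCayley π × f π ≡ τ
  surjective τ τ-cayley =
    reverse (f (reverse τ)) ,
    IsCayley-resp-↭ (↭-sym (↭-reverse _)) (into _ (IsCayley-resp-↭ (↭-sym (↭-reverse τ)) τ-cayley)) ,
    reverse-injective (f-inv (reverse τ))

stackSort-reverse-cons : ∀ σ x t → length t < length σ →
  stackSort σ (reverse (x ∷ t)) ≡ run σ [ x ] t []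
stackSort-reverse-cons σ x t t<σ = begin
  stackSort σ (reverse (x ∷ t))     ≡⟨ cong (stackSort σ) (unfold-reverse x t) ⟩
  run σ (reverse t ++ [ x ]) [] []  ≡⟨ run-reverse-avoiding σ t [] [ x ] [] t++[]∌σ ⟩
  run σ [ x ] (t ++ []) []          ≡⟨ cong (λ s → run σ [ x ] s []) (++-identityʳ t) ⟩
  run σ [ x ] t []                  ∎
  where
  open ≡-Reasoning
  t++[]∌σ : contains (t ++ []) σ ≡ false
  t++[]∌σ = avoids-longer (t ++ []) σ
    (subst (λ n → n < length σ) (cong length (sym (++-identityʳ t))) t<σ)

stackSort-reverse-self : ∀ a b rest → stackSort (a ∷ b ∷ rest) (reverse (a ∷ b ∷ rest)) ≡ b ∷ a ∷ rest
stackSort-reverse-self a b rest = trans (stackSort-reverse-cons σ a (b ∷ rest) (n<1+n _)) pops-b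
  where
  σ : Word
  σ = a ∷ b ∷ rest
  pops-b : run σ [ a ] (b ∷ rest) [] ≡ b ∷ a ∷ rest
  pops-b rewrite push-pops σ a b rest [] (contains-refl σ)
               | push-avoiding σ a rest [ b ] (avoids-longer (a ∷ rest) σ (n<1+n _)) = refl

stackSort-reverse-swapped : ∀ a b rest → ¬ a ≡ b →
  stackSort (a ∷ b ∷ rest) (reverse (b ∷ a ∷ rest)) ≡ b ∷ a ∷ rest
stackSort-reverse-swapped a b rest a≢b =
  trans (stackSort-reverse-cons σ b (a ∷ rest) (n<1+n _)) pops-nothing
  where
  σ : Word
  σ = a ∷ b ∷ rest
  pops-nothing : run σ [ b ] (a ∷ rest) [] ≡ b ∷ a ∷ rest
  pops-nothing rewrite push-avoiding σ b (a ∷ rest) [] (swapped-avoids a b rest a≢b) = refl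

stackSort-injectiveOnC⇒σ₁≡σ₂ : ∀ a b rest → IsCayley (a ∷ b ∷ rest) →
  (∀ π τ → IsCayley π → IsCayley τ →
     stackSort (a ∷ b ∷ rest) π ≡ stackSort (a ∷ b ∷ rest) τ → π ≡ τ) →
  a ≡ b
stackSort-injectiveOnC⇒σ₁≡σ₂ a b rest σ-cayley injective = decidable-stable (a ≟ b) λ a≢b →
  a≢b (∷-injectiveˡ (reverse-injective {x = a ∷ b ∷ rest} {y = b ∷ a ∷ rest}
    (injective (reverse (a ∷ b ∷ rest)) (reverse (b ∷ a ∷ rest)) reverse-cayley swapped-cayley
      (trans (stackSort-reverse-self a b rest) (sym (stackSort-reverse-swapped a b rest a≢b))))))
  where
  reverse-cayley : IsCayley (reverse (a ∷ b ∷ rest))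
  reverse-cayley = IsCayley-resp-↭ (↭-sym (↭-reverse _)) σ-cayley
  swapped-cayley : IsCayley (reverse (b ∷ a ∷ rest))
  swapped-cayley = IsCayley-resp-↭ (↭-sym (↭-reverse _)) (IsCayley-resp-↭ (↭-swap a b ↭-refl) σ-cayley)

corollary2 : ∀ (a b : ℕ) (rest : Word) → IsCayley (a ∷ b ∷ rest) →
    (BijectiveOnC (stackSort (a ∷ b ∷ rest)) ⇔ (a ≡ b))
    × (a ≡ b →
        BijectiveOnC (stackSort (a ∷ b ∷ rest))
        × (∀ π → IsCayley π → stackSort (a ∷ b ∷ rest) π ↭ π)
        × (∀ π → IsCayley π →
             reverse (stackSort (a ∷ b ∷ rest) (reverse (stackSort (a ∷ b ∷ rest) π))) ≡ π))
corollary2 a b rest σ-cayley =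
  mk⇔ (λ (_ , injective , _) → stackSort-injectiveOnC⇒σ₁≡σ₂ a b rest σ-cayley injective) bijective ,
  λ a≡b → bijective a≡b , (λ π _ → stackSort-↭ _ π) , (λ π _ → involutive a≡b π)
  where
  involutive : a ≡ b → ∀ π →
    reverse (stackSort (a ∷ b ∷ rest) (reverse (stackSort (a ∷ b ∷ rest) π))) ≡ π
  involutive refl = reverse∘stackSort-involutive a rest
  bijective : a ≡ b → BijectiveOnC (stackSort (a ∷ b ∷ rest))
  bijective a≡b = reverse-involution⇒bijectiveOnC _ (stackSort-↭ _) (involutive a≡b)
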